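{- Let $L,R$ be nonempty subsets of a group $G$ such that $\mathcal{W}(L)$ and $\mathcal{W}(R)$ are subgroups of $G$. Then $2\mathrm{S}(G;L,R)$ is strongly connected if and only if $G=\mathcal{W}(L)\mathcal{W}(R)$ and some element of $\bar{L}$ or of $\bar{R}$ is strongly connected to $e$.
   Context: For a group $G$ with identity $e$ and nonempty subsets $L,R\subseteq G$, the two-sided group digraph $2\mathrm{S}(G;L,R)$ has vertex set $G$ and a directed arc $(g,h)$ if and only if $h=l^{ -1}gr$ for some $l\in L$, $r\in R$. Vertices $g,h$ are strongly connected if there are directed paths from $g$ to $h$ and from $h$ to $g$; the digraph is strongly connected if all pairs of vertices are. $\bar{L}=L\cup L^{ -1}$, $\bar{R}=R\cup R^{ -1}$; for a nonempty set $S$, $\mathcal{W}(S)$ is the set of all products $s_1\cdots s_n$ with $n\ge1$, $s_i\in S$; $AB=\{ab:a\in A,b\in B\}$. -}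

module Defs where

open import Level using (Level; _⊔_)
open import Algebra.Bundles using (Group)
open import Data.Product using (Σ; ∃; _×_; _,_)
open import Data.Sum using (_⊎_)
open import Relation.Unary using (Pred)
open import Relation.Binary.Construct.Closure.ReflexiveTransitive using (Star)

module TwoSided {c ℓ : Level} (G : Group c ℓ) where
  open Group G

  Subset : (ℓ′ : Level) → Set (c ⊔ Level.suc ℓ′)
  Subset ℓ′ = Pred Carrier ℓ′

  Nonempty : ∀ {ℓ′} → Subset ℓ′ → Set (c ⊔ ℓ′)
  Nonempty S = ∃ λ x → S x

  data Word {ℓ′} (S : Subset ℓ′) : Carrier → Set (c ⊔ ℓ′) where
    single : ∀ {s} → S s → Word S s
    cons   : ∀ {s w} → S s → Word S w → Word S (s ∙ w)

  𝒲 : ∀ {ℓ′} → Subset ℓ′ → Subset (c ⊔ ℓ ⊔ ℓ′)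
  𝒲 S g = ∃ λ w → Word S w × g ≈ w

  bar : ∀ {ℓ′} → Subset ℓ′ → Subset ℓ′
  bar S x = S x ⊎ S (x ⁻¹)

  IsSubgroup : ∀ {ℓ′} → Subset ℓ′ → Set (c ⊔ ℓ′)
  IsSubgroup H = H ε × (∀ {x y} → H x → H y → H (x ∙ y)) × (∀ {x} → H x → H (x ⁻¹))

  _·_ : ∀ {ℓ₁ ℓ₂} → Subset ℓ₁ → Subset ℓ₂ → Subset (c ⊔ ℓ ⊔ ℓ₁ ⊔ ℓ₂)
  (A · B) g = ∃ λ a → ∃ λ b → A a × B b × g ≈ a ∙ b

  module Digraph {ℓ₁ ℓ₂} (L : Subset ℓ₁) (R : Subset ℓ₂) where
    Arc : Carrier → Carrier → Set (c ⊔ ℓ ⊔ ℓ₁ ⊔ ℓ₂)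
    Arc g h = ∃ λ l → ∃ λ r → L l × R r × h ≈ (l ⁻¹ ∙ g) ∙ r

    Path : Carrier → Carrier → Set (c ⊔ ℓ ⊔ ℓ₁ ⊔ ℓ₂)
    Path g h = ∃ λ h′ → Star Arc g h′ × h′ ≈ h

    StronglyConnectedPair : Carrier → Carrier → Set (c ⊔ ℓ ⊔ ℓ₁ ⊔ ℓ₂)
    StronglyConnectedPair g h = Path g h × Path h g

    StronglyConnected : Set (c ⊔ ℓ ⊔ ℓ₁ ⊔ ℓ₂)
    StronglyConnected = ∀ g h → StronglyConnectedPair g h

module Submission where

-- A walk along arcs (l₁,r₁), …, (lₙ,rₙ) sends g to u⁻¹gv with u = l₁⋯lₙ and
-- v = r₁⋯rₙ; call such a pair (u,v) balanced.  Paths are exactly balanced moves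
-- (module Moves).  Padding products to a common length (using l l⁻¹ = e) shows
-- that the balanced pairs form a subgroup T of 𝒲(L) × 𝒲(R), so reaching every
-- vertex from e already gives strong connectivity.  Forward direction: a path
-- e ⇝ g gives g = u⁻¹v ∈ 𝒲(L)𝒲(R), and any l ∈ L serves as x.  Backward
-- direction (module Connectivity): the kernel N = {z | (e,z) ∈ T} contains every
-- commutator [b,r] with b ∈ 𝒲(R), r ∈ R; a path e ⇝ x yields a pivot c with
-- (c, cr) ∈ T for all r ∈ R, hence (u, ub) ∈ T for every b ∈ 𝒲(R), and together
-- with G = 𝒲(L)𝒲(R) these moves reach every vertex.

open import Defs
open import Level using (Level; _⊔_)
open import Algebra.Bundles using (Group)
open import Data.Bool using (Bool; true; false)
open import Data.Fin using (Fin; zero; suc)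
open import Data.Fin.Properties using (_≟_)
open import Data.List using (List; []; _∷_)
open import Data.Nat using (ℕ; zero; suc; _+_; _*_)
open import Data.Nat.Tactic.RingSolver using (solve-∀)
open import Data.Product using (∃; ∃₂; _×_; _,_; proj₁; proj₂)
open import Data.Sum using (_⊎_; inj₁; inj₂)
open import Data.Vec using (Vec; lookup; []; _∷_)
open import Function.Bundles using (_⇔_; mk⇔)
open import Relation.Nullary using (yes; no)
open import Relation.Binary.PropositionalEquality as ≡ using (_≡_)
open import Relation.Binary.Construct.Closure.ReflexiveTransitive using (Star; _◅_) renaming (ε to nil)

-- A decision procedure for equations in an arbitrary group: both sides are
-- normalised to freely reduced words over signed variables.
module GroupSolver {c ℓ : Level} (G : Group c ℓ) where
  open Group G
  open import Algebra.Properties.Group G using (ε⁻¹≈ε; ⁻¹-involutive; ⁻¹-anti-homo-∙)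
  open import Relation.Binary.Reasoning.Setoid setoid

  infixl 7 _∙′_
  infix  8 _⁻¹′

  data Expr (n : ℕ) : Set where
    var   : Fin n → Expr n
    ε′    : Expr n
    _∙′_  : Expr n → Expr n → Expr n
    _⁻¹′  : Expr n → Expr n

  x₀ : ∀ {n} → Expr (suc n)
  x₀ = var zero
  x₁ : ∀ {n} → Expr (suc (suc n))
  x₁ = var (suc zero)
  x₂ : ∀ {n} → Expr (suc (suc (suc n)))
  x₂ = var (suc (suc zero))
  x₃ : ∀ {n} → Expr (suc (suc (suc (suc n))))
  x₃ = var (suc (suc (suc zero)))
  x₄ : ∀ {n} → Expr (suc (suc (suc (suc (suc n)))))
  x₄ = var (suc (suc (suc (suc zero))))

  -- A literal is a variable or its inverse (flag false); a normal form is a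
  -- word of literals in which no literal is followed by its inverse.
  Literal : ℕ → Set
  Literal n = Fin n × Bool

  Normal : ℕ → Set
  Normal n = List (Literal n)

  module _ {n : ℕ} (ρ : Vec Carrier n) where
    ⟦_⟧ : Expr n → Carrier
    ⟦ var i ⟧  = lookup ρ i
    ⟦ ε′ ⟧     = ε
    ⟦ e ∙′ f ⟧ = ⟦ e ⟧ ∙ ⟦ f ⟧
    ⟦ e ⁻¹′ ⟧  = ⟦ e ⟧ ⁻¹

    ⟦_⟧ₗ : Literal n → Carrier
    ⟦ i , true ⟧ₗ  = lookup ρ i
    ⟦ i , false ⟧ₗ = lookup ρ i ⁻¹

    ⟦_⟧ₙ : Normal n → Carrier
    ⟦ [] ⟧ₙ    = ε
    ⟦ a ∷ w ⟧ₙ = ⟦ a ⟧ₗ ∙ ⟦ w ⟧ₙ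

  push : ∀ {n} → Literal n → Normal n → Normal n
  push a [] = a ∷ []
  push (i , s) ((j , t) ∷ w) with i ≟ j | s | t
  ... | yes _ | true  | false = w
  ... | yes _ | false | true  = w
  ... | _     | _     | _     = (i , s) ∷ (j , t) ∷ w

  _++ₙ_ : ∀ {n} → Normal n → Normal n → Normal n
  []      ++ₙ w′ = w′
  (a ∷ w) ++ₙ w′ = push a (w ++ₙ w′)

  flip : ∀ {n} → Literal n → Literal n
  flip (i , true)  = i , false
  flip (i , false) = i , true

  invert : ∀ {n} → Normal n → Normal n
  invert []      = []
  invert (a ∷ w) = invert w ++ₙ (flip a ∷ [])

  normalise : ∀ {n} → Expr n → Normal n
  normalise (var i)  = (i , true) ∷ []
  normalise ε′       = []
  normalise (e ∙′ f) = normalise e ++ₙ normalise f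
  normalise (e ⁻¹′)  = invert (normalise e)

  module _ {n : ℕ} (ρ : Vec Carrier n) where
    private
      cancel : ∀ x y → x ∙ (x ⁻¹ ∙ y) ≈ y
      cancel x y = begin
        x ∙ (x ⁻¹ ∙ y)  ≈⟨ sym (assoc _ _ _) ⟩
        x ∙ x ⁻¹ ∙ y    ≈⟨ ∙-congʳ (inverseʳ x) ⟩
        ε ∙ y           ≈⟨ identityˡ y ⟩
        y               ∎

      cancel⁻¹ : ∀ x y → x ⁻¹ ∙ (x ∙ y) ≈ y
      cancel⁻¹ x y = begin
        x ⁻¹ ∙ (x ∙ y)  ≈⟨ sym (assoc _ _ _) ⟩
        x ⁻¹ ∙ x ∙ y    ≈⟨ ∙-congʳ (inverseˡ x) ⟩
        ε ∙ y           ≈⟨ identityˡ y ⟩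
        y               ∎

    push-correct : ∀ a w → ⟦ ρ ⟧ₙ (push a w) ≈ ⟦ ρ ⟧ₗ a ∙ ⟦ ρ ⟧ₙ w
    push-correct a [] = refl
    push-correct (i , s) ((j , t) ∷ w) with i ≟ j | s | t
    ... | yes ≡.refl | true  | false = sym (cancel _ _)
    ... | yes ≡.refl | false | true  = sym (cancel⁻¹ _ _)
    ... | yes ≡.refl | true  | true  = refl
    ... | yes ≡.refl | false | false = refl
    ... | no _     | _     | _     = refl

    ++ₙ-correct : ∀ w w′ → ⟦ ρ ⟧ₙ (w ++ₙ w′) ≈ ⟦ ρ ⟧ₙ w ∙ ⟦ ρ ⟧ₙ w′
    ++ₙ-correct [] w′ = sym (identityˡ _)
    ++ₙ-correct (a ∷ w) w′ = begin
      ⟦ ρ ⟧ₙ (push a (w ++ₙ w′))              ≈⟨ push-correct a (w ++ₙ w′) ⟩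
      ⟦ ρ ⟧ₗ a ∙ ⟦ ρ ⟧ₙ (w ++ₙ w′)            ≈⟨ ∙-congˡ (++ₙ-correct w w′) ⟩
      ⟦ ρ ⟧ₗ a ∙ (⟦ ρ ⟧ₙ w ∙ ⟦ ρ ⟧ₙ w′)       ≈⟨ sym (assoc _ _ _) ⟩
      ⟦ ρ ⟧ₗ a ∙ ⟦ ρ ⟧ₙ w ∙ ⟦ ρ ⟧ₙ w′         ∎

    flip-correct : ∀ a → ⟦ ρ ⟧ₗ (flip a) ≈ ⟦ ρ ⟧ₗ a ⁻¹
    flip-correct (i , true)  = refl
    flip-correct (i , false) = sym (⁻¹-involutive _)

    invert-correct : ∀ w → ⟦ ρ ⟧ₙ (invert w) ≈ ⟦ ρ ⟧ₙ w ⁻¹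
    invert-correct [] = sym ε⁻¹≈ε
    invert-correct (a ∷ w) = begin
      ⟦ ρ ⟧ₙ (invert w ++ₙ (flip a ∷ []))        ≈⟨ ++ₙ-correct (invert w) (flip a ∷ []) ⟩
      ⟦ ρ ⟧ₙ (invert w) ∙ (⟦ ρ ⟧ₗ (flip a) ∙ ε)  ≈⟨ ∙-cong (invert-correct w) (trans (identityʳ _) (flip-correct a)) ⟩
      ⟦ ρ ⟧ₙ w ⁻¹ ∙ ⟦ ρ ⟧ₗ a ⁻¹                  ≈⟨ sym (⁻¹-anti-homo-∙ _ _) ⟩
      (⟦ ρ ⟧ₗ a ∙ ⟦ ρ ⟧ₙ w) ⁻¹                   ∎

    normalise-correct : ∀ e → ⟦ ρ ⟧ e ≈ ⟦ ρ ⟧ₙ (normalise e)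
    normalise-correct (var i)  = sym (identityʳ _)
    normalise-correct ε′       = refl
    normalise-correct (e ∙′ f) = trans (∙-cong (normalise-correct e) (normalise-correct f))
                                       (sym (++ₙ-correct (normalise e) (normalise f)))
    normalise-correct (e ⁻¹′)  = trans (⁻¹-cong (normalise-correct e)) (sym (invert-correct (normalise e)))

  solve : ∀ {n} (ρ : Vec Carrier n) (e f : Expr n) → normalise e ≡ normalise f → ⟦ ρ ⟧ e ≈ ⟦ ρ ⟧ f
  solve ρ e f same = begin
    ⟦ ρ ⟧ e                ≈⟨ normalise-correct ρ e ⟩
    ⟦ ρ ⟧ₙ (normalise e)   ≡⟨ ≡.cong (⟦ ρ ⟧ₙ) same ⟩
    ⟦ ρ ⟧ₙ (normalise f)   ≈⟨ normalise-correct ρ f ⟨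
    ⟦ ρ ⟧ f                ∎

-- Products of exactly n elements of a subset S.  Keeping track of the length
-- is what lets a product over L be paired with a product over R into a walk.
module Products {c ℓ : Level} (G : Group c ℓ) where
  open Group G
  open TwoSided G

  data Product {ℓ′} (S : Subset ℓ′) : ℕ → Carrier → Set (c ⊔ ℓ ⊔ ℓ′) where
    empty : ∀ {x} → x ≈ ε → Product S zero x
    cons  : ∀ {n s w x} → S s → Product S n w → x ≈ s ∙ w → Product S (suc n) x

  module _ {ℓ′} {S : Subset ℓ′} where

    product-resp : ∀ {n x y} → Product S n x → x ≈ y → Product S n y
    product-resp (empty x≈ε)    x≈y = empty (trans (sym x≈y) x≈ε)
    product-resp (cons Ss p x≈)  x≈y = cons Ss p (trans (sym x≈y) x≈)

    infixr 5 _++ₚ_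
    _++ₚ_ : ∀ {m n x y} → Product S m x → Product S n y → Product S (m + n) (x ∙ y)
    empty x≈ε   ++ₚ q = product-resp q (sym (trans (∙-congʳ x≈ε) (identityˡ _)))
    cons Ss p e ++ₚ q = cons Ss (p ++ₚ q) (trans (∙-congʳ e) (assoc _ _ _))

    product-power : ∀ {n} → Product S n ε → ∀ k → Product S (k * n) ε
    product-power p zero    = empty refl
    product-power p (suc k) = product-resp (p ++ₚ product-power p k) (identityˡ ε)

    product-pad : ∀ {m n x} → Product S n ε → Product S m x → ∀ k → Product S (m + k * n) x
    product-pad unit p k = product-resp (p ++ₚ product-power unit k) (identityʳ _)

    product-cancel : ∀ {m s} → S s → Product S m (s ⁻¹) → Product S (suc m) ε
    product-cancel Ss p = cons Ss p (sym (inverseʳ _))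

    product-exists : ∀ {s} → S s → ∀ n → ∃ λ x → Product S n x
    product-exists Ss zero    = ε , empty refl
    product-exists Ss (suc n) with product-exists Ss n
    ... | x , p = _ , cons Ss p refl

    word⇒product : ∀ {w} → Word S w → ∃ λ n → Product S n w
    word⇒product (single Ss) = 1 , cons Ss (empty refl) (sym (identityʳ _))
    word⇒product (cons Ss W) with word⇒product W
    ... | n , p = suc n , cons Ss p refl

    𝒲⇒product : ∀ {x} → 𝒲 S x → ∃ λ n → Product S n x
    𝒲⇒product (w , W , x≈w) with word⇒product W
    ... | n , p = n , product-resp p (sym x≈w)

    𝒲-resp : ∀ {x y} → 𝒲 S x → x ≈ y → 𝒲 S y
    𝒲-resp (w , W , x≈w) x≈y = w , W , trans (sym x≈y) x≈w

    𝒲-single : ∀ {s} → S s → 𝒲 S s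
    𝒲-single Ss = _ , single Ss , refl

    -- When 𝒲(S) is a subgroup it also contains the empty product ε.
    product⇒𝒲 : IsSubgroup (𝒲 S) → ∀ {n x} → Product S n x → 𝒲 S x
    product⇒𝒲 (𝒲ε , _ , _) (empty x≈ε)     = 𝒲-resp 𝒲ε (sym x≈ε)
    product⇒𝒲 H@(_ , 𝒲∙ , _) (cons Ss p e) = 𝒲-resp (𝒲∙ (𝒲-single Ss) (product⇒𝒲 H p)) (sym e)

-- The move (u , v) sends g to u⁻¹ g v; arcs of 2S(G;L,R) are the moves (l , r)
-- with l ∈ L, r ∈ R.  Moves compose like a right action of G × G on G.
module Action {c ℓ : Level} (G : Group c ℓ) where
  open Group G
  open GroupSolver G

  act : Carrier → Carrier → Carrier → Carrier
  act u v g = u ⁻¹ ∙ g ∙ v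

  act-cong : ∀ {u u′ v v′ g g′} → u ≈ u′ → v ≈ v′ → g ≈ g′ → act u v g ≈ act u′ v′ g′
  act-cong u≈ v≈ g≈ = ∙-cong (∙-cong (⁻¹-cong u≈) g≈) v≈

  act-identity : ∀ g → act ε ε g ≈ g
  act-identity g = solve (g ∷ []) (ε′ ⁻¹′ ∙′ x₀ ∙′ ε′) x₀ ≡.refl

  act-∙ : ∀ u u′ v v′ g → act u′ v′ (act u v g) ≈ act (u ∙ u′) (v ∙ v′) g
  act-∙ u u′ v v′ g = solve (u ∷ u′ ∷ v ∷ v′ ∷ g ∷ [])
    (x₁ ⁻¹′ ∙′ (x₀ ⁻¹′ ∙′ x₄ ∙′ x₂) ∙′ x₃) ((x₀ ∙′ x₁) ⁻¹′ ∙′ x₄ ∙′ (x₂ ∙′ x₃)) ≡.refl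

-- Balanced moves: pairs (u , v) where u is a product of n elements of L and v
-- of n elements of R.  They are exactly the moves realised by walks.
module Moves {c ℓ ℓ₁ ℓ₂ : Level} (G : Group c ℓ) (L : TwoSided.Subset G ℓ₁) (R : TwoSided.Subset G ℓ₂) where
  open Group G
  open import Algebra.Properties.Group G using (ε⁻¹≈ε; ⁻¹-anti-homo-∙)
  open TwoSided G
  open Digraph L R
  open Products G
  open Action G
  open GroupSolver G

  Balanced : Carrier → Carrier → Set (c ⊔ ℓ ⊔ ℓ₁ ⊔ ℓ₂)
  Balanced u v = ∃ λ n → Product L n u × Product R n v

  MoveTo : Carrier → Carrier → Set (c ⊔ ℓ ⊔ ℓ₁ ⊔ ℓ₂)
  MoveTo g h = ∃₂ λ u v → Balanced u v × h ≈ act u v g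

  balanced-resp : ∀ {u u′ v v′} → u ≈ u′ → v ≈ v′ → Balanced u v → Balanced u′ v′
  balanced-resp u≈ v≈ (n , p , q) = n , product-resp p u≈ , product-resp q v≈

  balanced-ε : Balanced ε ε
  balanced-ε = 0 , empty refl , empty refl

  balanced-arc : ∀ {l r} → L l → R r → Balanced l r
  balanced-arc Ll Rr = 1 , cons Ll (empty refl) (sym (identityʳ _)) , cons Rr (empty refl) (sym (identityʳ _))

  balanced-∙ : ∀ {u u′ v v′} → Balanced u v → Balanced u′ v′ → Balanced (u ∙ u′) (v ∙ v′)
  balanced-∙ (m , p , q) (n , p′ , q′) = m + n , p ++ₚ p′ , q ++ₚ q′

  walk : ∀ {n u v} → Product L n u → Product R n v → ∀ g → Path g (act u v g)
  walk (empty u≈ε) (empty v≈ε) g = g , nil , sym (trans (act-cong u≈ε v≈ε refl) (act-identity g))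
  walk (cons {s = l} Ll p u≈) (cons {s = r} Rr q v≈) g with walk p q (act l r g)
  ... | h , steps , h≈ = h , (l , r , Ll , Rr , refl) ◅ steps ,
                         trans h≈ (trans (act-∙ l _ r _ g) (sym (act-cong u≈ v≈ refl)))

  move⇒path : ∀ {g h} → MoveTo g h → Path g h
  move⇒path {g} (u , v , (n , p , q) , h≈) with walk p q g
  ... | h′ , steps , h′≈ = h′ , steps , trans h′≈ (sym h≈)

  star⇒move : ∀ {g h} → Star Arc g h → MoveTo g h
  star⇒move {g} nil = ε , ε , balanced-ε , sym (act-identity g)
  star⇒move {g} ((l , r , Ll , Rr , g₁≈) ◅ steps) with star⇒move steps
  ... | u , v , uv , h≈ = l ∙ u , r ∙ v , balanced-∙ (balanced-arc Ll Rr) uv ,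
                          trans h≈ (trans (act-cong refl refl g₁≈) (act-∙ l u r v g))

  path⇒move : ∀ {g h} → Path g h → MoveTo g h
  path⇒move (h′ , steps , h′≈h) with star⇒move steps
  ... | u , v , uv , h′≈ = u , v , uv , trans (sym h′≈h) h′≈

  module Inverses (L-inv : ∀ {l} → L l → 𝒲 L (l ⁻¹)) (R-inv : ∀ {r} → R r → 𝒲 R (r ⁻¹)) where

    -- Write l⁻¹ and r⁻¹ as products of lengths m and n, then pad both to the
    -- common length m + n(m+1) = n + m(n+1) using l l⁻¹ = ε and r r⁻¹ = ε.
    balanced-arc⁻¹ : ∀ {l r} → L l → R r → Balanced (l ⁻¹) (r ⁻¹)
    balanced-arc⁻¹ {r = r} Ll Rr with 𝒲⇒product (L-inv Ll) | 𝒲⇒product (R-inv Rr)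
    ... | m , p | n , q =
      m + n * suc m ,
      product-pad (product-cancel Ll p) p n ,
      ≡.subst (λ k → Product R k (r ⁻¹)) (common-length n m) (product-pad (product-cancel Rr q) q m)
      where
        common-length : ∀ a b → a + b * suc a ≡ b + a * suc b
        common-length = solve-∀

    -- (l w)⁻¹ = w⁻¹ l⁻¹: invert the factor pairs one by one, in reverse order.
    balanced-⁻¹ : ∀ {u v} → Balanced u v → Balanced (u ⁻¹) (v ⁻¹)
    balanced-⁻¹ (n , p , q) = invert-pairs p q
      where
        invert-pairs : ∀ {n u v} → Product L n u → Product R n v → Balanced (u ⁻¹) (v ⁻¹)
        invert-pairs (empty u≈ε) (empty v≈ε) =
          balanced-resp (sym (trans (⁻¹-cong u≈ε) ε⁻¹≈ε)) (sym (trans (⁻¹-cong v≈ε) ε⁻¹≈ε)) balanced-ε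
        invert-pairs (cons Ll p u≈) (cons Rr q v≈) =
          balanced-resp (sym (trans (⁻¹-cong u≈) (⁻¹-anti-homo-∙ _ _)))
                        (sym (trans (⁻¹-cong v≈) (⁻¹-anti-homo-∙ _ _)))
                        (balanced-∙ (invert-pairs p q) (balanced-arc⁻¹ Ll Rr))

    -- Hence reaching every vertex from ε already makes the digraph strongly
    -- connected: to go from g to h, undo the move to g and perform the one to h.
    move-via-ε : ∀ {g h} → MoveTo ε g → MoveTo ε h → MoveTo g h
    move-via-ε (u , v , uv , g≈) (u′ , v′ , uv′ , h≈) =
      u ⁻¹ ∙ u′ , v ⁻¹ ∙ v′ , balanced-∙ (balanced-⁻¹ uv) uv′ ,
      trans h≈ (sym (trans (act-cong refl refl g≈) undo-then-move))
      where
        undo-then-move : act (u ⁻¹ ∙ u′) (v ⁻¹ ∙ v′) (act u v ε) ≈ act u′ v′ ε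
        undo-then-move = solve (u ∷ u′ ∷ v ∷ v′ ∷ [])
          ((x₀ ⁻¹′ ∙′ x₁) ⁻¹′ ∙′ (x₀ ⁻¹′ ∙′ ε′ ∙′ x₂) ∙′ (x₂ ⁻¹′ ∙′ x₃)) (x₁ ⁻¹′ ∙′ ε′ ∙′ x₃) ≡.refl

    strongly-connected : (∀ g → MoveTo ε g) → StronglyConnected
    strongly-connected reach g h =
      move⇒path (move-via-ε (reach g) (reach h)) , move⇒path (move-via-ε (reach h) (reach g))

-- For the backward
-- direction, write N = {z | (ε , z) balanced}; N is a subgroup,
-- normalised by 𝒲(R), containing r⁻¹r′ for r, r′ ∈ R, hence every commutator
-- [b , r] with b ∈ 𝒲(R), r ∈ R.  A neighbour x ∈ L̄ ∪ R̄ of ε yields a pivot c ∈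
-- 𝒲(R) with (c , c r) balanced for all r ∈ R; working modulo N, a pivot gives
-- for every b ∈ 𝒲(R) a balanced move (u , u b), and with 𝒲(L)𝒲(R) = G these
-- moves reach every vertex from ε.
module Connectivity {c ℓ ℓ₁ ℓ₂ : Level} (G : Group c ℓ)
  (L : TwoSided.Subset G ℓ₁) (R : TwoSided.Subset G ℓ₂)
  (L-nonempty : TwoSided.Nonempty G L) (R-nonempty : TwoSided.Nonempty G R)
  (L-subgroup : TwoSided.IsSubgroup G (TwoSided.𝒲 G L))
  (R-subgroup : TwoSided.IsSubgroup G (TwoSided.𝒲 G R)) where
  open Group G
  open TwoSided G
  open Digraph L R
  open Products G
  open GroupSolver G
  open Moves G L R

  l₀ : Carrier
  l₀ = proj₁ L-nonempty

  Ll₀ : L l₀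
  Ll₀ = proj₂ L-nonempty

  r₀ : Carrier
  r₀ = proj₁ R-nonempty

  Rr₀ : R r₀
  Rr₀ = proj₂ R-nonempty

  𝒲L-inv : ∀ {a} → 𝒲 L a → 𝒲 L (a ⁻¹)
  𝒲L-inv = proj₂ (proj₂ L-subgroup)

  𝒲R-∙ : ∀ {b b′} → 𝒲 R b → 𝒲 R b′ → 𝒲 R (b ∙ b′)
  𝒲R-∙ = proj₁ (proj₂ R-subgroup)

  𝒲R-inv : ∀ {b} → 𝒲 R b → 𝒲 R (b ⁻¹)
  𝒲R-inv = proj₂ (proj₂ R-subgroup)

  open Inverses (λ Ll → 𝒲L-inv (𝒲-single Ll)) (λ Rr → 𝒲R-inv (𝒲-single Rr))

  balanced-members : ∀ {u v} → Balanced u v → 𝒲 L u × 𝒲 R v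
  balanced-members (n , p , q) = product⇒𝒲 L-subgroup p , product⇒𝒲 R-subgroup q

  -- Every element of 𝒲(L) (resp. 𝒲(R)) is a coordinate of a balanced move,
  -- completed by a power of r₀ (resp. l₀).
  balanced-fst : ∀ {a} → 𝒲 L a → ∃ λ v → Balanced a v
  balanced-fst Aa with 𝒲⇒product Aa
  ... | n , p with product-exists Rr₀ n
  ... | v , q = v , n , p , q

  balanced-snd : ∀ {b} → 𝒲 R b → ∃ λ u → Balanced u b
  balanced-snd Bb with 𝒲⇒product Bb
  ... | n , q with product-exists Ll₀ n
  ... | u , p = u , n , p , q

  -- The kernel N, with its closure properties: products, quotients of
  -- generators r⁻¹r′ (from (l₀ , r)⁻¹(l₀ , r′)), and conjugation by 𝒲(R)
  -- (conjugating (ε , z) by a balanced pair (u , b)).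
  Kernel : Carrier → Set (c ⊔ ℓ ⊔ ℓ₁ ⊔ ℓ₂)
  Kernel z = Balanced ε z

  kernel-∙ : ∀ {z z′} → Kernel z → Kernel z′ → Kernel (z ∙ z′)
  kernel-∙ k k′ = balanced-resp (identityˡ ε) refl (balanced-∙ k k′)

  kernel-quotient : ∀ {r r′} → R r → R r′ → Kernel (r ⁻¹ ∙ r′)
  kernel-quotient Rr Rr′ =
    balanced-resp (inverseˡ l₀) refl (balanced-∙ (balanced-⁻¹ (balanced-arc Ll₀ Rr)) (balanced-arc Ll₀ Rr′))

  kernel-conj : ∀ {b z} → 𝒲 R b → Kernel z → Kernel (b ∙ z ∙ b ⁻¹)
  kernel-conj Bb k with balanced-snd Bb
  ... | u , ub = balanced-resp (solve (u ∷ []) (x₀ ∙′ ε′ ∙′ x₀ ⁻¹′) ε′ ≡.refl) refl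
                               (balanced-∙ (balanced-∙ ub k) (balanced-⁻¹ ub))

  balanced-shift : ∀ {u v z} → Balanced u v → Kernel z → Balanced u (v ∙ z)
  balanced-shift t k = balanced-resp (identityʳ _) refl (balanced-∙ t k)

  [_,_] : Carrier → Carrier → Carrier
  [ x , y ] = x ⁻¹ ∙ y ⁻¹ ∙ x ∙ y

  -- [s , r] = s⁻¹(r⁻¹s)s · s⁻¹r with both factors in N.
  commutator-generators : ∀ {s r} → R s → R r → Kernel [ s , r ]
  commutator-generators {s} {r} Rs Rr =
    balanced-resp refl
      (solve (s ∷ r ∷ []) (x₀ ⁻¹′ ∙′ (x₁ ⁻¹′ ∙′ x₀) ∙′ x₀ ⁻¹′ ⁻¹′ ∙′ (x₀ ⁻¹′ ∙′ x₁))
                          (x₀ ⁻¹′ ∙′ x₁ ⁻¹′ ∙′ x₀ ∙′ x₁) ≡.refl)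
      (kernel-∙ (kernel-conj (𝒲R-inv (𝒲-single Rs)) (kernel-quotient Rr Rs)) (kernel-quotient Rs Rr))

  -- [s w , r] = w⁻¹[s , r]w · [w , r].
  commutator-word : ∀ {w r} → Word R w → R r → Kernel [ w , r ]
  commutator-word (single Rs) Rr = commutator-generators Rs Rr
  commutator-word {r = r} (cons {s} {w} Rs W) Rr =
    balanced-resp refl
      (solve (s ∷ w ∷ r ∷ []) (x₁ ⁻¹′ ∙′ (x₀ ⁻¹′ ∙′ x₂ ⁻¹′ ∙′ x₀ ∙′ x₂) ∙′ x₁ ⁻¹′ ⁻¹′ ∙′ (x₁ ⁻¹′ ∙′ x₂ ⁻¹′ ∙′ x₁ ∙′ x₂))
                              ((x₀ ∙′ x₁) ⁻¹′ ∙′ x₂ ⁻¹′ ∙′ (x₀ ∙′ x₁) ∙′ x₂) ≡.refl)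
      (kernel-∙ (kernel-conj (𝒲R-inv (w , W , refl)) (commutator-generators Rs Rr)) (commutator-word W Rr))

  commutator-kernel : ∀ {b r} → 𝒲 R b → R r → Kernel [ b , r ]
  commutator-kernel (w , W , b≈w) Rr =
    balanced-resp refl (∙-congʳ (∙-cong (∙-congʳ (⁻¹-cong (sym b≈w))) (sym b≈w))) (commutator-word W Rr)

  Pivot : Carrier → Set (c ⊔ ℓ ⊔ ℓ₁ ⊔ ℓ₂)
  Pivot c = 𝒲 R c × (∀ {r} → R r → Balanced c (c ∙ r))

  -- One r₁ suffices, since c r₁ · r₁⁻¹r = c r with r₁⁻¹r ∈ N ...
  pivot-right : ∀ {c r₁} → 𝒲 R c → R r₁ → Balanced c (c ∙ r₁) → Pivot c
  pivot-right {c} {r₁} Bc Rr₁ t = Bc , λ {r} Rr →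
    balanced-resp refl (solve (c ∷ r₁ ∷ r ∷ []) (x₀ ∙′ x₁ ∙′ (x₁ ⁻¹′ ∙′ x₂)) (x₀ ∙′ x₂) ≡.refl)
                  (balanced-shift t (kernel-quotient Rr₁ Rr))

  -- ... and r₁ c may replace c r₁, since r₁ c · [c , r₁] = c r₁.
  pivot-left : ∀ {c r₁} → 𝒲 R c → R r₁ → Balanced c (r₁ ∙ c) → Pivot c
  pivot-left {c} {r₁} Bc Rr₁ t = pivot-right Bc Rr₁
    (balanced-resp refl (solve (c ∷ r₁ ∷ []) (x₁ ∙′ x₀ ∙′ (x₀ ⁻¹′ ∙′ x₁ ⁻¹′ ∙′ x₀ ∙′ x₁)) (x₀ ∙′ x₁) ≡.refl)
                   (balanced-shift t (commutator-kernel Bc Rr₁)))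

  -- A vertex x ∈ L̄ ∪ R̄ reachable from ε, x = α⁻¹β with (α , β) balanced,
  -- produces a pivot; each of the four cases multiplies (α , β)^{±1} by an arc.
  pivot-from-neighbour : ∀ {x} → (bar L x ⊎ bar R x) → MoveTo ε x → ∃ Pivot
  pivot-from-neighbour {x} side (α , β , t , x≈) = from side
    where
      Bβ : 𝒲 R β
      Bβ = proj₂ (balanced-members t)

      αx≈β : α ∙ x ≈ β
      αx≈β = trans (∙-congˡ x≈) (solve (α ∷ β ∷ []) (x₀ ∙′ (x₀ ⁻¹′ ∙′ ε′ ∙′ x₁)) x₁ ≡.refl)

      x⁻¹α⁻¹≈β⁻¹ : x ⁻¹ ∙ α ⁻¹ ≈ β ⁻¹
      x⁻¹α⁻¹≈β⁻¹ = trans (∙-congʳ (⁻¹-cong x≈))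
        (solve (α ∷ β ∷ []) ((x₀ ⁻¹′ ∙′ ε′ ∙′ x₁) ⁻¹′ ∙′ x₀ ⁻¹′) (x₁ ⁻¹′) ≡.refl)

      βx⁻¹≈α : β ∙ x ⁻¹ ≈ α
      βx⁻¹≈α = trans (∙-congˡ (⁻¹-cong x≈)) (solve (α ∷ β ∷ []) (x₁ ∙′ (x₀ ⁻¹′ ∙′ ε′ ∙′ x₁) ⁻¹′) x₀ ≡.refl)

      from : (bar L x ⊎ bar R x) → ∃ Pivot
      from (inj₁ (inj₁ Lx))   = β , Bβ , λ Rr → balanced-resp αx≈β refl (balanced-∙ t (balanced-arc Lx Rr))
      from (inj₁ (inj₂ Lx⁻¹)) = β ⁻¹ , pivot-left (𝒲R-inv Bβ) Rr₀
        (balanced-resp x⁻¹α⁻¹≈β⁻¹ refl (balanced-∙ (balanced-arc Lx⁻¹ Rr₀) (balanced-⁻¹ t)))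
      from (inj₂ (inj₁ Rx))   = α , pivot-right (𝒲-resp (𝒲R-∙ Bβ (𝒲R-inv (𝒲-single Rx))) βx⁻¹≈α) Rx
        (balanced-resp refl (sym αx≈β) t)
      from (inj₂ (inj₂ Rx⁻¹)) = α ⁻¹ , pivot-left (𝒲R-inv (𝒲-resp (𝒲R-∙ Bβ (𝒲-single Rx⁻¹)) βx⁻¹≈α)) Rx⁻¹
        (balanced-resp refl (sym x⁻¹α⁻¹≈β⁻¹) (balanced-⁻¹ t))

  -- From a pivot c, induction on a word b = r w over R: (c , c r)(u , u w) is
  -- (c u , c u r w) up to the factor w⁻¹[u , r]w ∈ N.
  pivot-reaches : ∀ {c b} → Pivot c → 𝒲 R b → ∃ λ u → 𝒲 R u × Balanced u (u ∙ b)
  pivot-reaches {c} (Bc , pivot) (w , W , b≈w) with pivot-word W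
    where
      pivot-word : ∀ {w} → Word R w → ∃ λ u → 𝒲 R u × Balanced u (u ∙ w)
      pivot-word (single Rr) = c , Bc , pivot Rr
      pivot-word (cons {r} {w} Rr W) with pivot-word W
      ... | u , Bu , t = c ∙ u , 𝒲R-∙ Bc Bu ,
        balanced-resp refl
          (solve (c ∷ r ∷ u ∷ w ∷ [])
            (x₀ ∙′ x₁ ∙′ (x₂ ∙′ x₃) ∙′ (x₃ ⁻¹′ ∙′ (x₂ ⁻¹′ ∙′ x₁ ⁻¹′ ∙′ x₂ ∙′ x₁) ∙′ x₃ ⁻¹′ ⁻¹′))
            (x₀ ∙′ x₂ ∙′ (x₁ ∙′ x₃)) ≡.refl)
          (balanced-shift (balanced-∙ (pivot Rr) t)
                          (kernel-conj (𝒲R-inv (w , W , refl)) (commutator-kernel Bu Rr)))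
  ... | u , Bu , t = u , Bu , balanced-resp refl (∙-congˡ (sym b≈w)) t

  -- g = a b is reached by (u a⁻¹ , u (b v⁻¹) v), where (a⁻¹ , v) is balanced and
  -- the pivot supplies (u , u (b v⁻¹)).
  reach-all : (∀ g → (𝒲 L · 𝒲 R) g) → ∃ Pivot → ∀ g → MoveTo ε g
  reach-all decompose (c , pivot) g with decompose g
  ... | a , b , Aa , Bb , g≈ab with balanced-fst (𝒲L-inv Aa)
  ... | v , t₁ with pivot-reaches pivot (𝒲R-∙ Bb (𝒲R-inv (proj₂ (balanced-members t₁))))
  ... | u , _ , t₂ = u ∙ a ⁻¹ , u ∙ (b ∙ v ⁻¹) ∙ v , balanced-∙ t₂ t₁ ,
    trans g≈ab (solve (u ∷ a ∷ b ∷ v ∷ [])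
                  (x₁ ∙′ x₂) ((x₀ ∙′ x₁ ⁻¹′) ⁻¹′ ∙′ ε′ ∙′ (x₀ ∙′ (x₂ ∙′ x₃ ⁻¹′) ∙′ x₃)) ≡.refl)

  -- Forward: a walk ε ⇝ g is a balanced move (u , v), so g = u⁻¹v ∈ 𝒲(L)𝒲(R);
  -- and any l ∈ L is strongly connected to ε.
  forward : StronglyConnected →
            (∀ g → (𝒲 L · 𝒲 R) g) × (∃ λ x → (bar L x ⊎ bar R x) × StronglyConnectedPair x ε)
  forward sc = (λ g → decomposition (path⇒move (proj₁ (sc ε g)))) , l₀ , inj₁ (inj₁ Ll₀) , sc l₀ ε
    where
      decomposition : ∀ {g} → MoveTo ε g → (𝒲 L · 𝒲 R) g
      decomposition (u , v , t , g≈) =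
        u ⁻¹ , v , 𝒲L-inv (proj₁ (balanced-members t)) , proj₂ (balanced-members t) , trans g≈ (∙-congʳ (identityʳ _))

  backward : (∀ g → (𝒲 L · 𝒲 R) g) × (∃ λ x → (bar L x ⊎ bar R x) × StronglyConnectedPair x ε) →
             StronglyConnected
  backward (decompose , x , side , _ , ε⇝x) =
    strongly-connected (reach-all decompose (pivot-from-neighbour side (path⇒move ε⇝x)))

corollary3p17 : ∀ {c ℓ ℓ₁ ℓ₂ : Level} (G : Group c ℓ) → let open TwoSided G in
    (L : Subset ℓ₁) (R : Subset ℓ₂) → Nonempty L → Nonempty R →
    IsSubgroup (𝒲 L) → IsSubgroup (𝒲 R) →
    (Digraph.StronglyConnected L R ⇔
      ((∀ g → (𝒲 L · 𝒲 R) g) ×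
       (∃ λ x → (bar L x ⊎ bar R x) × Digraph.StronglyConnectedPair L R x (Group.ε G))))
corollary3p17 G L R L-nonempty R-nonempty L-subgroup R-subgroup = mk⇔ forward backward
  where open Connectivity G L R L-nonempty R-nonempty L-subgroup R-subgroup
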